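{- For every $n>0$: if $W_n=\bigcup_{i\ge1}W_{n,i}$ is infinite, then $\mathbb{A}\cap W_n\neq\emptyset$.
   Context: Model. An additive BSS RAM has real registers $Z_1,Z_2,\ldots$ and finitely many index registers $I_1,\ldots,I_k$ (holding positive integers). Its program is a finite labelled list of instructions of the forms $Z_i:=Z_j+Z_k$, $Z_i:=Z_j-Z_k$, $Z_j:=c$ ($c$ a constant), "if $Z_j=0$ then goto $l_1$ else goto $l_2$", "if $Z_j\geq 0$ then goto $l_1$ else goto $l_2$", $Z_{I_j}:=Z_{I_k}$, $I_j:=1$, $I_j:=I_j+1$, "if $I_j=I_k$ then goto $l_1$ else goto $l_2$", together with halting/output. Inputs are tuples in $\mathbb{R}^\infty=\bigcup_{n\ge1}\mathbb{R}^n$, loaded into $Z_1,\ldots,Z_n$ with every index register set to $n$. $\mathsf{M}^1_{\rm add}$: machines using only constants $0,1$; $\mathsf{M}^{1,=}_{\rm add}$: only constants $0,1$ and only equality tests. For $\mathcal{O}\subseteq\mathbb{R}^\infty$, machines in $\mathsf{M}^1_{\rm add}(\mathcal{O})$ may additionally execute "if $(Z_1,\ldots,Z_{I_1})\in\mathcal{O}$ then goto $l_1$ else goto $l_2$". Numbering of oracle machines: for $\mathcal{O}\subseteq\mathbb{R}^\infty$ and $\mathcal{M}\in\mathsf{M}^1_{\rm add}(\mathcal{O})$ with binary program code $(c_1,\ldots,c_l)$ put $K_\mathcal{M}=2^l+\sum_{i=1}^lc_i2^{l-i}$ and $\mathcal{M}^{\mathcal{O}}_{K_\mathcal{M}}=\mathcal{M}$;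 for other $k$ let $\mathcal{M}^{\mathcal{O}}_k$ be a fixed always-halting machine. The sets $W_i$, $W_{i,s}$ and $\mathbb{A}$: let $\mathcal{N}_1,\mathcal{N}_2,\ldots$ be an effective list of all machines in $\mathsf{M}^{1,=}_{\rm add}$, $W_i$ the set of positive integers in the halting set of $\mathcal{N}_i$, $\bar{\mathcal N}_i\in\mathsf{M}^{1,=}_{\rm add}$ a machine enumerating $W_i$, and $W_{i,s}\subseteq W_i$ the set of positive integers enumerated by $\bar{\mathcal N}_i$ for the input $s$ within the first $s$ steps (so $W_i=\bigcup_s W_{i,s}$). $\mathbb{A}_1=\emptyset$. Given $\mathbb{A}_s$, for $j\le s$ let $a(j,s)$ be the greatest integer used in an oracle query by $\mathcal{M}^{\mathbb{A}_s}_j$ on input $j$ within the first $s$ steps if $\mathcal{M}^{\mathbb{A}_s}_j$ halts on $j$ within $s$ steps, and $0$ otherwise. $\phi(i,s,x)$ means $2i<x$ and $a(j,s)<x$ for all $j\le i$. $I_s=\{i\le s\mid\mathbb{A}_s\cap W_{i,s}=\emptyset,\ \exists x\in W_{i,s}\,\phi(i,s,x)\}$. If $I_s=\emptyset$, $\mathbb{A}_{s+1}=\mathbb{A}_s$; otherwise with $i_s=\min I_s$ and $x_{i_s}=\min\{x\in W_{i_s,s}\mid\phi(i_s,s,x)\}$, $\mathbb{A}_{s+1}=\mathbb{A}_s\cup\{x_{i_s}\}$. $\mathbb{A}=\bigcup_{s\ge1}\mathbb{A}_s$. -}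

module Defs where

open import Data.Nat using (ℕ; zero; suc; _+_; _*_; _<_; _≤_; _<ᵇ_; _≡ᵇ_; _⊔_)
open import Data.Integer using (ℤ; +_; -[1+_])
open import Data.Fin using (Fin; zero; suc)
open import Data.Fin.Properties using () renaming (_≟_ to _≟F_)
open import Data.Bool using (Bool; true; false; if_then_else_; _∧_; _∨_; not)
open import Data.List using (List; []; _∷_; _++_; map; upTo; foldr; concat)
open import Data.Bool.ListAction using (any; all)
open import Data.List.Relation.Unary.All using (All)
open import Data.List.Membership.Propositional using (_∈_)
open import Data.Maybe using (Maybe; just; nothing; fromMaybe)
open import Data.Product using (_×_; _,_; ∃; proj₁)
open import Relation.Nullary.Decidable using (⌊_⌋)
open import Relation.Binary.PropositionalEquality using (_≡_)

-- Additive BSS RAMs with constants 0,1 (and an oracle instruction).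
-- Real registers hold integers only: all inputs considered here are
-- integer tuples and the only constants are 0 and 1.
-- Register indices are natural numbers (Z_1, Z_2, ... ; Z_0 unused).
-- A program with (suc k) index registers I_1..I_{suc k} (as Fin (suc k)).

data Instr (k : ℕ) : Set where
  addI   : ℕ → ℕ → ℕ → Instr k
  subI   : ℕ → ℕ → ℕ → Instr k
  constI : ℕ → Bool → Instr k            -- Z_j := c, c = 0 (false) or 1 (true)
  ifZeroI : ℕ → ℕ → ℕ → Instr k
  ifGeqI  : ℕ → ℕ → ℕ → Instr k
  copyI  : Fin k → Fin k → Instr k
  isetI  : Fin k → Instr k
  incI   : Fin k → Instr k
  ifIEqI : Fin k → Fin k → ℕ → ℕ → Instr k
  oracleI : ℕ → ℕ → Instr k              -- if (Z_1..Z_{I_1}) ∈ O goto l1 else l2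
  haltI  : Instr k

-- Labels are 0,1,...; a non-jump instruction continues with the next label;
-- the machine halts at haltI or at a label outside the program.
record Program : Set where
  field
    nIdx : ℕ
    body : List (Instr (suc nIdx))
open Program public

-- Machines of M^{1,=}_add: no order tests, no oracle instructions.
eqOnlyInstr : ∀ {k} → Instr k → Bool
eqOnlyInstr (ifGeqI _ _ _) = false
eqOnlyInstr (oracleI _ _)  = false
eqOnlyInstr _              = true

EqOnly : Program → Set
EqOnly P = All (λ ins → eqOnlyInstr ins ≡ true) (body P)

Oracle : Set
Oracle = List ℤ → Bool

record Config (P : Program) : Set where
  constructor cfg
  field
    lab : ℕ
    Z   : ℕ → ℤ
    I   : Fin (suc (nIdx P)) → ℕ
open Config public

nth : ∀ {A : Set} → List A → ℕ → Maybe A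
nth []       _       = nothing
nth (x ∷ xs) zero    = just x
nth (x ∷ xs) (suc m) = nth xs m

updZ : (ℕ → ℤ) → ℕ → ℤ → (ℕ → ℤ)
updZ f i v m = if m ≡ᵇ i then v else f m

updI : ∀ {k} → (Fin k → ℕ) → Fin k → ℕ → (Fin k → ℕ)
updI f i v m = if ⌊ m ≟F i ⌋ then v else f m

isZeroℤ : ℤ → Bool
isZeroℤ (+ zero) = true
isZeroℤ _        = false

nonNegℤ : ℤ → Bool
nonNegℤ (+ _)    = true
nonNegℤ -[1+ _ ] = false

range1 : ℕ → List ℕ
range1 n = map suc (upTo n)

exec : (P : Program) → Oracle → Config P → Instr (suc (nIdx P))
     → Maybe (Config P × Maybe (List ℤ))
exec P O (cfg l z ι) (addI i j m)   = just (cfg (suc l) (updZ z i (z j Data.Integer.+ z m)) ι , nothing)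
exec P O (cfg l z ι) (subI i j m)   = just (cfg (suc l) (updZ z i (z j Data.Integer.- z m)) ι , nothing)
exec P O (cfg l z ι) (constI j c)   = just (cfg (suc l) (updZ z j (if c then + 1 else + 0)) ι , nothing)
exec P O (cfg l z ι) (ifZeroI j a b) = just (cfg (if isZeroℤ (z j) then a else b) z ι , nothing)
exec P O (cfg l z ι) (ifGeqI j a b)  = just (cfg (if nonNegℤ (z j) then a else b) z ι , nothing)
exec P O (cfg l z ι) (copyI j m)    = just (cfg (suc l) (updZ z (ι j) (z (ι m))) ι , nothing)
exec P O (cfg l z ι) (isetI j)      = just (cfg (suc l) z (updI ι j 1) , nothing)
exec P O (cfg l z ι) (incI j)       = just (cfg (suc l) z (updI ι j (suc (ι j))) , nothing)
exec P O (cfg l z ι) (ifIEqI j m a b) = just (cfg (if ι j ≡ᵇ ι m then a else b) z ι , nothing)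
exec P O (cfg l z ι) (oracleI a b)  =
  let q = map z (range1 (ι zero)) in
  just (cfg (if O q then a else b) z ι , just q)
exec P O c haltI = nothing

-- one step; nothing = the configuration is halting; otherwise the
-- successor configuration and the oracle query made (if any)
step : (P : Program) → Oracle → Config P → Maybe (Config P × Maybe (List ℤ))
step P O c with nth (body P) (lab c)
... | nothing  = nothing
... | just ins = exec P O c ins

maybeToList : ∀ {A : Set} → Maybe A → List A
maybeToList nothing  = []
maybeToList (just x) = x ∷ []

-- run for at most t steps: (halted within t steps?, oracle queries made)
run : (P : Program) → Oracle → ℕ → Config P → Bool × List (List ℤ)
run P O zero c with step P O c
... | nothing = true , []
... | just _  = false , []
run P O (suc t) c with step P O c
... | nothing = true , []
... | just (c' , q) with run P O t c'
...   | h , qs = h , (maybeToList q ++ qs)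

inputVal : List ℤ → ℕ → ℤ
inputVal xs zero    = + 0
inputVal xs (suc m) = fromMaybe (+ 0) (nth xs m)

init : (P : Program) → List ℤ → Config P
init P xs = cfg 0 (inputVal xs) (λ _ → Data.List.length xs)

haltsWithin : (P : Program) → Oracle → ℕ → List ℤ → Bool
haltsWithin P O t xs = proj₁ (run P O t (init P xs))

noOracle : Oracle
noOracle _ = false

-- Finite subsets of ℕ as oracles (a set B ⊆ ℕ viewed as a set of 1-tuples)

memb : ℕ → List ℕ → Bool
memb x ys = any (λ y → x ≡ᵇ y) ys

setOracle : List ℕ → Oracle
setOracle B ((+ x) ∷ []) = memb x B
setOracle B _            = false

clamp : ℤ → ℕ
clamp (+ n)    = n
clamp -[1+ _ ] = 0

maxList : List ℕ → ℕ
maxList = foldr _⊔_ 0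

InW : (ℕ → Program) → ℕ → ℕ → Set
InW N i x = (1 ≤ x) × ∃ λ t → haltsWithin (N i) noOracle t (+ x ∷ []) ≡ true

-- The construction of 𝔸.  code j = 𝓜_j (the numbered oracle machines),
-- Wst i s = W_{i,s} (a finite list).

module Construction (code : ℕ → Program) (Wst : ℕ → ℕ → List ℕ) where

  aval : List ℕ → ℕ → ℕ → ℕ
  aval As j s with run (code j) (setOracle As) s (init (code j) (+ j ∷ []))
  ... | true  , qs = maxList (map clamp (concat qs))
  ... | false , _  = 0

  φ : List ℕ → ℕ → ℕ → ℕ → Bool
  φ As i s x = (2 * i <ᵇ x) ∧ all (λ j → aval As j s <ᵇ x) (range1 i)

  filt : (ℕ → Bool) → List ℕ → List ℕ
  filt p []       = []
  filt p (x ∷ xs) = if p x then x ∷ filt p xs else filt p xs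

  minList : ℕ → List ℕ → ℕ
  minList m []       = m
  minList m (x ∷ xs) = minList (if x <ᵇ m then x else m) xs

  firstAct : List ℕ → ℕ → List ℕ → Maybe ℕ
  firstAct As s []       = nothing
  firstAct As s (i ∷ is) with any (λ y → memb y As) (Wst i s) | filt (φ As i s) (Wst i s)
  ... | false | x ∷ xs = just (minList x xs)
  ... | _     | _      = firstAct As s is

  nextA : ℕ → List ℕ → List ℕ
  nextA s As with firstAct As s (range1 s)
  ... | nothing = As
  ... | just x  = x ∷ As

  -- Astage s = 𝔸_s for s ≥ 1 (Astage 0 is an unused dummy)
  Astage : ℕ → List ℕ
  Astage zero          = []
  Astage (suc zero)    = []
  Astage (suc (suc t)) = nextA (suc t) (Astage (suc t))

  InA : ℕ → Set
  InA x = ∃ λ s → x ∈ Astage s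

module Submission where

-- Suppose 𝔸 ∩ W_n = ∅; we derive ⊥, arguing under double negation, which is
-- harmless since the goal is a negation.  Each requirement i < n is eventually
-- settled: either met (𝔸_s ∩ W_{i,s} ≠ ∅, which persists) or never met; fix a
-- stage s₀ settling all of them.  After s₀ no index i < n acts, so every
-- number entering 𝔸 exceeds the uses a(j,s), j ≤ n (condition φ).  Hence a
-- computation of 𝓜_j on j (j ≤ n) that has halted after s₀ is never injured,
-- and the uses a(j,s) are bounded after s₀ by some B.  Since W_n is unbounded,
-- some x > B, 2n lies in W_{n,s} at a late stage s, making n a candidate; so an
-- index i ≤ n acts at s, which must be n itself, putting an element of W_n into 𝔸.

open import Defs
open import Data.Nat using (ℕ; zero; suc; _*_; _<_; _≤_; _≤′_; ≤′-refl; ≤′-step; _⊔_; _<ᵇ_; _≡ᵇ_; z≤n; s≤s)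
open import Data.Nat.Properties
open import Data.Integer using (ℤ; +_; -[1+_])
open import Data.Bool using (Bool; true; false; T)
open import Data.Bool.Properties using (T-≡; T-∧; ¬-not)
open import Data.Bool.ListAction using (any; all)
open import Data.List using (List; []; _∷_; _++_; [_]; map; concat; upTo)
open import Data.List.Properties using (map-++; ++-assoc; ++-identityʳ; upTo-∷ʳ)
open import Data.List.Membership.Propositional using (_∈_; find; lose)
open import Data.List.Membership.Propositional.Properties using (∈-++⁺ˡ; ∈-++⁺ʳ; ∈-map⁺; ∈-map⁻; ∈-concat⁺′; ∈-upTo⁺; ∈-upTo⁻)
open import Data.List.Relation.Unary.Any using (here; there)
import Data.List.Relation.Unary.All as All
open import Data.List.Relation.Unary.Any.Properties using (any⁺; any⁻)
open import Data.List.Relation.Unary.All.Properties using (all⁺; all⁻)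
open import Data.Maybe using (Maybe; just; nothing)
open import Data.Product using (∃; _×_; _,_; proj₁; proj₂)
open import Data.Sum using (_⊎_; inj₁; inj₂; [_,_]′)
open import Data.Empty using (⊥)
open import Effect.Monad using (RawMonad)
open import Function.Bundles using (Equivalence)
open import Relation.Nullary using (¬_; Dec; yes; no)
open import Relation.Nullary.Negation using (DoubleNegation; ¬¬-Monad; ¬¬-map)
open import Relation.Nullary.Decidable using (¬¬-excluded-middle)
open import Relation.Binary.PropositionalEquality using (_≡_; _≢_; refl; sym; trans; cong; subst; module ≡-Reasoning)

open Equivalence using (to; from)

any-true⁺ : ∀ {A : Set} (p : A → Bool) {x xs} → x ∈ xs → T (p x) → any p xs ≡ true
any-true⁺ p x∈xs px = to T-≡ (any⁺ p (lose x∈xs px))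

any-true⁻ : ∀ {A : Set} (p : A → Bool) xs → any p xs ≡ true → ∃ λ x → x ∈ xs × T (p x)
any-true⁻ p xs e = find (any⁻ p xs (from T-≡ e))

all-true⁺ : ∀ {A : Set} (p : A → Bool) xs → (∀ {x} → x ∈ xs → T (p x)) → all p xs ≡ true
all-true⁺ p xs h = to T-≡ (all⁻ p (All.tabulate h))

all-true⁻ : ∀ {A : Set} (p : A → Bool) xs → all p xs ≡ true → ∀ {x} → x ∈ xs → T (p x)
all-true⁻ p xs e = All.lookup (all⁺ p xs (from T-≡ e))

∈⇒memb : ∀ {x ys} → x ∈ ys → T (memb x ys)
∈⇒memb {x} x∈ys = from T-≡ (any-true⁺ (x ≡ᵇ_) x∈ys (≡⇒≡ᵇ x x refl))

memb⇒∈ : ∀ {x} ys → T (memb x ys) → x ∈ ys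
memb⇒∈ {x} ys e with y , y∈ys , x≡ᵇy ← any-true⁻ (x ≡ᵇ_) ys (to T-≡ e) =
  subst (_∈ ys) (sym (≡ᵇ⇒≡ x y x≡ᵇy)) y∈ys

maxList-upper : ∀ {x} xs → x ∈ xs → x ≤ maxList xs
maxList-upper (y ∷ ys) (here refl) = m≤m⊔n y (maxList ys)
maxList-upper (y ∷ ys) (there x∈ys) = ≤-trans (maxList-upper ys x∈ys) (m≤n⊔m y (maxList ys))

∈-range1⁻ : ∀ {j m} → j ∈ range1 m → 1 ≤ j × j ≤ m
∈-range1⁻ j∈ with k , k∈upTo , refl ← ∈-map⁻ suc j∈ = s≤s z≤n , ∈-upTo⁻ k∈upTo

∈-range1⁺ : ∀ {j m} → 1 ≤ j → j ≤ m → j ∈ range1 m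
∈-range1⁺ {suc k} _ k<m = ∈-map⁺ suc (∈-upTo⁺ k<m)

range1-snoc : ∀ m → range1 (suc m) ≡ range1 m ++ [ suc m ]
range1-snoc m = begin
  map suc (upTo (suc m))       ≡⟨ cong (map suc) (upTo-∷ʳ m) ⟨
  map suc (upTo m ++ [ m ])    ≡⟨ map-++ suc (upTo m) [ m ] ⟩
  range1 m ++ [ suc m ]        ∎
  where open ≡-Reasoning

range1-prefix : ∀ {n s} → n ≤′ s → ∃ λ rest → range1 s ≡ range1 n ++ rest
range1-prefix ≤′-refl = [] , sym (++-identityʳ _)
range1-prefix {n} (≤′-step {s} n≤′s) with rest , eq ← range1-prefix n≤′s =
  rest ++ [ suc s ] , (begin
    range1 (suc s)               ≡⟨ range1-snoc s ⟩
    range1 s ++ [ suc s ]        ≡⟨ cong (_++ [ suc s ]) eq ⟩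
    (range1 n ++ rest) ++ [ suc s ] ≡⟨ ++-assoc (range1 n) rest [ suc s ] ⟩
    range1 n ++ rest ++ [ suc s ] ∎)
  where open ≡-Reasoning

<⇒≢ᵇ : ∀ {x y} → x < y → (x ≡ᵇ y) ≡ false
<⇒≢ᵇ {x} {y} x<y = ¬-not (λ x≡ᵇy → <-irrefl (≡ᵇ⇒≡ x y (from T-≡ x≡ᵇy)) x<y)

¬¬-common-witness : (P : ℕ → ℕ → Set) → (∀ {i a b} → a ≤ b → P i a → P i b) →
                    (∀ i → DoubleNegation (∃ (P i))) → ∀ m → DoubleNegation (∃ λ b → ∀ {i} → i < m → P i b)
¬¬-common-witness P mono exists zero none = none (0 , λ ())
¬¬-common-witness P mono exists (suc m) = do
    b , below-m ← ¬¬-common-witness P mono exists m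
    c , at-m    ← exists m
    pure (b ⊔ c , λ {i} i<1+m → [ (λ i<m → mono (m≤m⊔n b c) (below-m i<m))
                             , (λ { refl → mono (m≤n⊔m b c) at-m }) ]′ (m≤n⇒m<n∨m≡n (≤-pred i<1+m)))
  where open RawMonad ¬¬-Monad

-- Oracle machines.  A run depends on the oracle only through the answers to the
-- queries it actually makes; this is what lets computations survive additions to 𝔸.

stepQueries : ∀ {P : Program} → Maybe (Config P × Maybe (List ℤ)) → List (List ℤ)
stepQueries nothing         = []
stepQueries (just (_ , mq)) = maybeToList mq

module _ (P : Program) where

  exec-oracle-independent : ∀ {O O′} c ins → (∀ {q} → q ∈ stepQueries (exec P O c ins) → O q ≡ O′ q) →
                            exec P O′ c ins ≡ exec P O c ins
  exec-oracle-independent (cfg l z ι) (oracleI a b) agree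
    rewrite agree (here refl) = refl
  exec-oracle-independent c (addI _ _ _)     _ = refl
  exec-oracle-independent c (subI _ _ _)     _ = refl
  exec-oracle-independent c (constI _ _)     _ = refl
  exec-oracle-independent c (ifZeroI _ _ _)  _ = refl
  exec-oracle-independent c (ifGeqI _ _ _)   _ = refl
  exec-oracle-independent c (copyI _ _)      _ = refl
  exec-oracle-independent c (isetI _)        _ = refl
  exec-oracle-independent c (incI _)         _ = refl
  exec-oracle-independent c (ifIEqI _ _ _ _) _ = refl
  exec-oracle-independent c haltI            _ = refl

  step-oracle-independent : ∀ {O O′} c → (∀ {q} → q ∈ stepQueries (step P O c) → O q ≡ O′ q) →
                            step P O′ c ≡ step P O c
  step-oracle-independent c agree with nth (body P) (lab c)
  ... | nothing  = refl
  ... | just ins = exec-oracle-independent c ins agree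

  halting-oracle-independent : ∀ {O O′} c → step P O c ≡ nothing → step P O′ c ≡ nothing
  halting-oracle-independent c halts =
    trans (step-oracle-independent c (λ q∈ → ∉[] (subst (λ r → _ ∈ stepQueries r) halts q∈))) halts
    where ∉[] : ∀ {A : Set} {q : List ℤ} → q ∈ [] → A
          ∉[] ()

  run-oracle-independent : ∀ {O O′} t c → (∀ {q} → q ∈ proj₂ (run P O t c) → O q ≡ O′ q) →
                           run P O′ t c ≡ run P O t c
  run-oracle-independent {O} {O′} zero c _ with step P O c in halts | step P O′ c in halts′
  ... | nothing | nothing = refl
  ... | just _  | just _  = refl
  ... | nothing | just _ with () ← trans (sym halts′) (halting-oracle-independent c halts)
  ... | just _  | nothing with () ← trans (sym halts) (halting-oracle-independent c halts′)
  run-oracle-independent {O} {O′} (suc t) c agree with step P O c in s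
  ... | nothing rewrite halting-oracle-independent {O} {O′} c s = refl
  ... | just (c′ , mq) with run P O t c′ in r
  ...   | h , qs rewrite trans (step-oracle-independent c (λ q∈ → agree (∈-++⁺ˡ (subst (λ x → _ ∈ stepQueries x) s q∈)))) s
                       | trans (run-oracle-independent t c′ (λ q∈ → agree (∈-++⁺ʳ (maybeToList mq) (subst (λ x → _ ∈ proj₂ x) r q∈)))) r
                       = refl

  run-halted-suc : ∀ {O} t c → proj₁ (run P O t c) ≡ true → run P O (suc t) c ≡ run P O t c
  run-halted-suc {O} zero c halted with step P O c
  ... | nothing = refl
  run-halted-suc {O} (suc t) c halted with step P O c
  ... | nothing = refl
  ... | just (c′ , mq) with run P O t c′ in r
  ...   | true , qs rewrite run-halted-suc t c′ (cong proj₁ r) | r = refl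

use : Bool × List (List ℤ) → ℕ
use (true , qs) = maxList (map clamp (concat qs))
use (false , _) = 0

use-unhalted : ∀ {r} → proj₁ r ≡ false → use r ≡ 0
use-unhalted {false , _} refl = refl

use-upper : ∀ {qs q x} → q ∈ qs → x ∈ q → clamp x ≤ use (true , qs)
use-upper q∈qs x∈q = maxList-upper _ (∈-map⁺ clamp (∈-concat⁺′ x∈q q∈qs))

setOracle-extend : ∀ A y q → (∀ {x} → x ∈ q → clamp x < y) → setOracle (y ∷ A) q ≡ setOracle A q
setOracle-extend A y []                  small = refl
setOracle-extend A y (+ x ∷ [])          small
  rewrite <⇒≢ᵇ (small (here refl)) = refl
setOracle-extend A y (-[1+ _ ] ∷ [])     small = refl
setOracle-extend A y (+ _ ∷ _ ∷ _)       small = refl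
setOracle-extend A y (-[1+ _ ] ∷ _ ∷ _)  small = refl

halted-form : ∀ {r : Bool × List (List ℤ)} → proj₁ r ≡ true → r ≡ (true , proj₂ r)
halted-form refl = refl

run-extend : ∀ P A y t c → proj₁ (run P (setOracle A) t c) ≡ true → use (run P (setOracle A) t c) < y →
             run P (setOracle (y ∷ A)) (suc t) c ≡ run P (setOracle A) t c
run-extend P A y t c halted small = begin
  run P (setOracle (y ∷ A)) (suc t) c ≡⟨ run-halted-suc P t c (trans (cong proj₁ same) halted) ⟩
  run P (setOracle (y ∷ A)) t c       ≡⟨ same ⟩
  run P (setOracle A) t c             ∎
  where
    open ≡-Reasoning
    same : run P (setOracle (y ∷ A)) t c ≡ run P (setOracle A) t c
    same = run-oracle-independent P t c (λ {q} q∈ → sym (setOracle-extend A y q (λ x∈q →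
             ≤-<-trans (use-upper q∈ x∈q) (subst (λ r → use r < y) (halted-form halted) small))))

module Stages (code : ℕ → Program) (Wst : ℕ → ℕ → List ℕ) where
  open Construction code Wst

  meets : List ℕ → ℕ → ℕ → Bool
  meets As s i = any (λ z → memb z As) (Wst i s)

  meets⁺ : ∀ {As s i y} → y ∈ Wst i s → y ∈ As → meets As s i ≡ true
  meets⁺ {As} y∈W y∈As = any-true⁺ (λ z → memb z As) y∈W (∈⇒memb y∈As)

  meets⁻ : ∀ {As s i} → meets As s i ≡ true → ∃ λ y → y ∈ Wst i s × y ∈ As
  meets⁻ {As} {s} {i} e with y , y∈W , y∈As ← any-true⁻ _ (Wst i s) e = y , y∈W , memb⇒∈ As y∈As

  Candidate : List ℕ → ℕ → ℕ → ℕ → Set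
  Candidate As s i y = meets As s i ≡ false × y ∈ Wst i s × φ As i s y ≡ true

  filt-sound : ∀ p xs {y} → y ∈ filt p xs → y ∈ xs × p y ≡ true
  filt-sound p (x ∷ xs) y∈ with p x in px | y∈
  ... | true  | here refl = here refl , px
  ... | true  | there y∈′ = let y∈xs , py = filt-sound p xs y∈′ in there y∈xs , py
  ... | false | y∈′       = let y∈xs , py = filt-sound p xs y∈′ in there y∈xs , py

  filt-nonempty : ∀ p xs {y} → y ∈ xs → p y ≡ true → ¬ filt p xs ≡ []
  filt-nonempty p (x ∷ xs) y∈ py with p x in px | y∈
  ... | true  | _         = λ ()
  ... | false | here refl with () ← trans (sym py) px
  ... | false | there y∈′ = filt-nonempty p xs y∈′ py

  minList-∈ : ∀ m xs → minList m xs ∈ m ∷ xs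
  minList-∈ m [] = here refl
  minList-∈ m (x ∷ xs) with x <ᵇ m
  ... | true with minList-∈ x xs
  ...   | here eq  = there (here eq)
  ...   | there p  = there (there p)
  minList-∈ m (x ∷ xs) | false with minList-∈ m xs
  ...   | here eq  = here eq
  ...   | there p  = there (there p)

  chosen-candidate : ∀ {As s i x xs} → meets As s i ≡ false → filt (φ As i s) (Wst i s) ≡ x ∷ xs →
                     Candidate As s i (minList x xs)
  chosen-candidate {As} {s} {i} {x} {xs} unmet eq =
    unmet , filt-sound (φ As i s) (Wst i s) (subst (minList x xs ∈_) (sym eq) (minList-∈ x xs))

  firstAct-sound : ∀ {As s y} is → firstAct As s is ≡ just y → ∃ λ i → i ∈ is × Candidate As s i y
  firstAct-sound {As} {s} (i ∷ is) chosen with meets As s i in unmet | filt (φ As i s) (Wst i s) in eq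
  ... | false | x ∷ xs with refl ← chosen = i , here refl , chosen-candidate unmet eq
  ... | true  | _      = let j , j∈ , cand = firstAct-sound is chosen in j , there j∈ , cand
  ... | false | []     = let j , j∈ , cand = firstAct-sound is chosen in j , there j∈ , cand

  further : ∀ {As s i′} {xs : List ℕ} {F : Maybe ℕ} →
            (∃ λ y → F ≡ just y × ∃ λ i → i ∈ xs × Candidate As s i y) →
            ∃ λ y → F ≡ just y × ∃ λ i → i ∈ i′ ∷ xs × Candidate As s i y
  further (y , chosen , i , i∈ , cand) = y , chosen , i , there i∈ , cand

  firstAct-prefix : ∀ {As s i₀ x₀} xs ys → i₀ ∈ xs → Candidate As s i₀ x₀ →
                    ∃ λ y → firstAct As s (xs ++ ys) ≡ just y × ∃ λ i → i ∈ xs × Candidate As s i y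
  firstAct-prefix {As} {s} (i ∷ xs) ys i₀∈ cand₀ with meets As s i in unmet | filt (φ As i s) (Wst i s) in eq | i₀∈
  ... | false | x ∷ xs′ | _ = minList x xs′ , refl , i , here refl , chosen-candidate unmet eq
  ... | true  | _       | here refl with () ← trans (sym unmet) (proj₁ cand₀)
  ... | false | []      | here refl with () ← filt-nonempty (φ As i s) (Wst i s) (proj₁ (proj₂ cand₀)) (proj₂ (proj₂ cand₀)) eq
  ... | true  | _       | there i₀∈′ = further (firstAct-prefix xs ys i₀∈′ cand₀)
  ... | false | []      | there i₀∈′ = further (firstAct-prefix xs ys i₀∈′ cand₀)

  Astage-suc : ∀ s → Astage (suc s) ≡ nextA s (Astage s)
  Astage-suc zero    = refl
  Astage-suc (suc s) = refl

  Acts : ℕ → ℕ → ℕ → Set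
  Acts s i y = Astage (suc s) ≡ y ∷ Astage s × Candidate (Astage s) s i y

  nextA-cases : ∀ s As → nextA s As ≡ As ⊎ ∃ λ y → firstAct As s (range1 s) ≡ just y × nextA s As ≡ y ∷ As
  nextA-cases s As with firstAct As s (range1 s)
  ... | nothing = inj₁ refl
  ... | just y  = inj₂ (y , refl , refl)

  nextA-chosen : ∀ {s As y} → firstAct As s (range1 s) ≡ just y → nextA s As ≡ y ∷ As
  nextA-chosen {s} {As} chosen with firstAct As s (range1 s)
  nextA-chosen refl | just y = refl

  Astage-step : ∀ s → Astage (suc s) ≡ Astage s ⊎ ∃ λ i → ∃ λ y → Acts s i y
  Astage-step s with nextA-cases s (Astage s)
  ... | inj₁ same = inj₁ (trans (Astage-suc s) same)
  ... | inj₂ (y , chosen , added) =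
    let i , _ , cand = firstAct-sound (range1 s) chosen in inj₂ (i , y , trans (Astage-suc s) added , cand)

  candidate-acts : ∀ {n s x} → 1 ≤ n → n ≤ s → Candidate (Astage s) s n x → ∃ λ i → ∃ λ y → i ≤ n × Acts s i y
  candidate-acts {n} {s} 1≤n n≤s cand
    with rest , split ← range1-prefix (≤⇒≤′ n≤s)
    with y , chosen , i , i∈ , cand′ ← firstAct-prefix (range1 n) rest (∈-range1⁺ 1≤n ≤-refl) cand
    = i , y , proj₂ (∈-range1⁻ i∈)
    , trans (Astage-suc s) (nextA-chosen {s} (subst (λ is → firstAct (Astage s) s is ≡ just y) (sym split) chosen))
    , cand′

  Astage-mono : ∀ {s s′ y} → s ≤′ s′ → y ∈ Astage s → y ∈ Astage s′
  Astage-mono ≤′-refl y∈ = y∈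
  Astage-mono {s′ = suc s′} (≤′-step s≤′s′) y∈ with Astage-step s′
  ... | inj₁ same             = subst (_ ∈_) (sym same) (Astage-mono s≤′s′ y∈)
  ... | inj₂ (_ , _ , added , _) = subst (_ ∈_) (sym added) (there (Astage-mono s≤′s′ y∈))

  aval-use : ∀ As j s → aval As j s ≡ use (run (code j) (setOracle As) s (init (code j) (+ j ∷ [])))
  aval-use As j s with run (code j) (setOracle As) s (init (code j) (+ j ∷ []))
  ... | true  , _ = refl
  ... | false , _ = refl

  φ⁻ : ∀ {As i s y j} → φ As i s y ≡ true → 1 ≤ j → j ≤ i → aval As j s < y
  φ⁻ {As} {i} {s} {y} holds 1≤j j≤i =
    <ᵇ⇒< _ _ (all-true⁻ _ (range1 i) (to T-≡ (proj₂ (to T-∧ (from T-≡ holds)))) (∈-range1⁺ 1≤j j≤i))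

  φ⁺ : ∀ {As i s y} → 2 * i < y → (∀ {j} → 1 ≤ j → j ≤ i → aval As j s < y) → φ As i s y ≡ true
  φ⁺ {As} {i} {s} {y} 2i<y below = to T-≡ (from T-∧ (<⇒<ᵇ 2i<y , from T-≡ (all-true⁺ _ (range1 i) uses-below)))
    where
      uses-below : ∀ {j} → j ∈ range1 i → T (aval As j s <ᵇ y)
      uses-below j∈ = let 1≤j , j≤i = ∈-range1⁻ j∈ in <⇒<ᵇ (below 1≤j j≤i)

true≢false : true ≢ false
true≢false ()

module Argument
  (code : ℕ → Program) (N : ℕ → Program) (Wst : ℕ → ℕ → List ℕ)
  (Wsound : ∀ i s x → x ∈ Wst i s → InW N i x)
  (Wcomplete : ∀ i x → InW N i x → ∃ λ s → x ∈ Wst i s)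
  (Wmono : ∀ i s s′ x → s ≤ s′ → x ∈ Wst i s → x ∈ Wst i s′)
  (n : ℕ) (0<n : 0 < n) (Wn-unbounded : ∀ m → ∃ λ x → m < x × InW N n x)
  (disjoint : ∀ x → Construction.InA code Wst x → InW N n x → ⊥) where

  open Construction code Wst
  open Stages code Wst

  satisfied : ℕ → ℕ → Bool
  satisfied i s = meets (Astage s) s i

  satisfied-mono : ∀ {i s s′} → s ≤ s′ → satisfied i s ≡ true → satisfied i s′ ≡ true
  satisfied-mono {i} {s} {s′} s≤s′ sat with y , y∈W , y∈A ← meets⁻ sat =
    meets⁺ (Wmono i s s′ y s≤s′ y∈W) (Astage-mono (≤⇒≤′ s≤s′) y∈A)

  Settled : ℕ → ℕ → Set
  Settled i s₀ = satisfied i s₀ ≡ true ⊎ (∀ s → satisfied i s ≡ false)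

  settled-mono : ∀ {i s₀ s₁} → s₀ ≤ s₁ → Settled i s₀ → Settled i s₁
  settled-mono s₀≤s₁ (inj₁ sat)   = inj₁ (satisfied-mono s₀≤s₁ sat)
  settled-mono s₀≤s₁ (inj₂ never) = inj₂ never

  settled-below : DoubleNegation (∃ λ s₀ → ∀ {i} → i < n → Settled i s₀)
  settled-below = ¬¬-common-witness Settled settled-mono settles n
    where
      settles : ∀ i → DoubleNegation (∃ (Settled i))
      settles i = ¬¬-map decide ¬¬-excluded-middle
        where
          decide : Dec (∃ λ s → satisfied i s ≡ true) → ∃ (Settled i)
          decide (yes (s , sat)) = s , inj₁ sat
          decide (no never)      = 0 , inj₂ (λ s → ¬-not (λ sat → never (s , sat)))

  n-unmet : ∀ s → satisfied n s ≡ false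
  n-unmet s = ¬-not λ met → let y , y∈W , y∈A = meets⁻ met in disjoint y (s , y∈A) (Wsound n s y y∈W)

  start : (j : ℕ) → Config (code j)
  start j = init (code j) (+ j ∷ [])

  R : ℕ → ℕ → Bool × List (List ℤ)
  R j s = run (code j) (setOracle (Astage s)) s (start j)

  a : ℕ → ℕ → ℕ
  a j s = aval (Astage s) j s

  Halted : ℕ → ℕ → Set
  Halted j s = proj₁ (R j s) ≡ true

  module AfterSettling (s₀ : ℕ) (settled : ∀ {i} → i < n → Settled i s₀) where

    -- After s₀ only indices i ≥ n act: a settled requirement never acts again.
    acting-index-large : ∀ {s i y} → s₀ ≤ s → Acts s i y → n ≤ i
    acting-index-large {s} {i} {y} s₀≤s (added , unmet , y∈W , _) = ≮⇒≥ low
      where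
        low : i < n → ⊥
        low i<n with settled i<n
        ... | inj₁ sat   = true≢false (trans (sym (satisfied-mono s₀≤s sat)) unmet)
        ... | inj₂ never = true≢false (trans (sym met-next) (never (suc s)))
          where
            met-next : satisfied i (suc s) ≡ true
            met-next = meets⁺ (Wmono i s (suc s) y (n≤1+n s) y∈W) (subst (y ∈_) (sym added) (here refl))

    late-additions-large : ∀ {s} → s₀ ≤ s → Astage (suc s) ≡ Astage s ⊎
                           ∃ λ y → Astage (suc s) ≡ y ∷ Astage s × (∀ {j} → 1 ≤ j → j ≤ n → a j s < y)
    late-additions-large {s} s₀≤s with Astage-step s
    ... | inj₁ same = inj₁ same
    ... | inj₂ (i , y , acts@(added , _ , _ , φ-holds)) =
      inj₂ (y , added , λ 1≤j j≤n → φ⁻ {Astage s} {i} {s} φ-holds 1≤j (≤-trans j≤n (acting-index-large s₀≤s acts)))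

    -- A computation of 𝓜_j (1 ≤ j ≤ n) halted at a stage t ≥ s₀ survives stage t:
    -- whatever enters 𝔸 lies above all its queries.
    survives-stage : ∀ {j t} → 1 ≤ j → j ≤ n → s₀ ≤ t → Halted j t → R j (suc t) ≡ R j t
    survives-stage {j} {t} 1≤j j≤n s₀≤t halted with late-additions-large s₀≤t
    ... | inj₁ same = trans (cong (λ A → run (code j) (setOracle A) (suc t) (start j)) same)
                            (run-halted-suc (code j) t (start j) halted)
    ... | inj₂ (y , added , large) = trans (cong (λ A → run (code j) (setOracle A) (suc t) (start j)) added)
                            (run-extend (code j) (Astage t) y t (start j) halted
                               (subst (_< y) (aval-use (Astage t) j t) (large 1≤j j≤n)))

    halted-stable : ∀ {j s s′} → 1 ≤ j → j ≤ n → s₀ ≤ s → Halted j s → s ≤′ s′ → R j s′ ≡ R j s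
    halted-stable _ _ _ _ ≤′-refl = refl
    halted-stable {j} {s} 1≤j j≤n s₀≤s halted (≤′-step {t} s≤′t) =
      trans (survives-stage 1≤j j≤n (≤-trans s₀≤s (≤′⇒≤ s≤′t)) (trans (cong proj₁ earlier) halted)) earlier
      where
        earlier : R j t ≡ R j s
        earlier = halted-stable 1≤j j≤n s₀≤s halted s≤′t

    use-constant : ∀ {j s t} → 1 ≤ j → j ≤ n → s₀ ≤ s → s₀ ≤ t → Halted j s → Halted j t → a j s ≡ a j t
    use-constant {j} {s} {t} 1≤j j≤n s₀≤s s₀≤t halted-s halted-t with ≤-total s t
    ... | inj₁ s≤t = trans (aval-use (Astage s) j s)
                       (trans (cong use (sym (halted-stable 1≤j j≤n s₀≤s halted-s (≤⇒≤′ s≤t))))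
                              (sym (aval-use (Astage t) j t)))
    ... | inj₂ t≤s = trans (aval-use (Astage s) j s)
                       (trans (cong use (halted-stable 1≤j j≤n s₀≤t halted-t (≤⇒≤′ t≤s)))
                              (sym (aval-use (Astage t) j t)))

    -- Classically the use of each 𝓜_j (1 ≤ j ≤ n) is bounded after s₀: it is 0 until
    -- 𝓜_j halts, and constant afterwards.
    UseBound : ℕ → ℕ → Set
    UseBound j B = 1 ≤ j → j ≤ n → ∀ {s} → s₀ ≤ s → a j s ≤ B

    use-bounded : ∀ j → DoubleNegation (∃ (UseBound j))
    use-bounded j = ¬¬-map bound ¬¬-excluded-middle
      where
        unhalted-use : ∀ s → ¬ Halted j s → a j s ≡ 0
        unhalted-use s unhalted = trans (aval-use (Astage s) j s) (use-unhalted (¬-not unhalted))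

        bound : Dec (∃ λ t → s₀ ≤ t × Halted j t) → ∃ (UseBound j)
        bound (no never) = 0 , λ _ _ {s} s₀≤s → ≤-reflexive (unhalted-use s (λ h → never (s , s₀≤s , h)))
        bound (yes (t , s₀≤t , halted-t)) = a j t , below-t
          where
            below-t : UseBound j (a j t)
            below-t 1≤j j≤n {s} s₀≤s with proj₁ (R j s) in h
            ... | true  = ≤-reflexive (use-constant 1≤j j≤n s₀≤s s₀≤t h halted-t)
            ... | false = subst (_≤ a j t) (sym (unhalted-use s (λ h′ → true≢false (trans (sym h′) h)))) z≤n

    uses-bounded : DoubleNegation (∃ λ B → ∀ {j} → j < suc n → UseBound j B)
    uses-bounded = ¬¬-common-witness UseBound (λ B≤B′ bound 1≤j j≤n s₀≤s → ≤-trans (bound 1≤j j≤n s₀≤s) B≤B′)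
                     use-bounded (suc n)

    -- No index i ≤ n acts after s₀: by the above i = n, and it would put an element of W_n into 𝔸.
    no-small-action : ∀ {s i y} → s₀ ≤ s → i ≤ n → Acts s i y → ⊥
    no-small-action {s} {i} {y} s₀≤s i≤n acts@(added , _ , y∈W , _) =
      disjoint y (suc s , subst (y ∈_) (sym added) (here refl)) (Wsound n s y (subst (λ k → y ∈ Wst k s) i≡n y∈W))
      where
        i≡n : i ≡ n
        i≡n = ≤-antisym i≤n (acting-index-large s₀≤s acts)

    n-candidate : ∀ {B s x} → (∀ {j} → j < suc n → UseBound j B) → s₀ ≤ s → B ⊔ 2 * n < x → x ∈ Wst n s →
                  Candidate (Astage s) s n x
    n-candidate {B} {s} {x} bounded s₀≤s large x∈W = n-unmet s , x∈W , φ⁺ {Astage s} {n} {s} (≤-<-trans (m≤n⊔m B (2 * n)) large) uses-below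
      where
        uses-below : ∀ {j} → 1 ≤ j → j ≤ n → a j s < x
        uses-below 1≤j j≤n = ≤-<-trans (bounded (s≤s j≤n) 1≤j j≤n s₀≤s) (≤-<-trans (m≤m⊔n B (2 * n)) large)

    bounded-uses-contradict : ∀ {B} → (∀ {j} → j < suc n → UseBound j B) → ⊥
    bounded-uses-contradict {B} bounded
      with x , large , x∈Wn ← Wn-unbounded (B ⊔ 2 * n)
      with s₁ , x∈Wns₁ ← Wcomplete n x x∈Wn
      = let s = s₀ ⊔ s₁ ⊔ n
            s₀≤s = ≤-trans (m≤m⊔n s₀ s₁) (m≤m⊔n (s₀ ⊔ s₁) n)
            cand = n-candidate bounded s₀≤s large (Wmono n s₁ s x (≤-trans (m≤n⊔m s₀ s₁) (m≤m⊔n (s₀ ⊔ s₁) n)) x∈Wns₁)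
            i , y , i≤n , acts = candidate-acts 0<n (m≤n⊔m (s₀ ⊔ s₁) n) cand
        in no-small-action s₀≤s i≤n acts

lemma3p9 : (code : ℕ → Program) (N : ℕ → Program) → (∀ i → EqOnly (N i)) →
    (Wst : ℕ → ℕ → List ℕ) →
    (∀ i s x → x ∈ Wst i s → InW N i x) →
    (∀ i x → InW N i x → ∃ λ s → x ∈ Wst i s) →
    (∀ i s s′ x → s ≤ s′ → x ∈ Wst i s → x ∈ Wst i s′) →
    ∀ n → 0 < n → (∀ m → ∃ λ x → m < x × InW N n x) →
    ¬ (∀ x → Construction.InA code Wst x → InW N n x → ⊥)
lemma3p9 code N _ Wst Wsound Wcomplete Wmono n 0<n Wn-unbounded disjoint =
  settled-below λ (s₀ , settled) →
  let open AfterSettling s₀ settled in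
  uses-bounded λ (B , bounded) →
  bounded-uses-contradict bounded
  where open Argument code N Wst Wsound Wcomplete Wmono n 0<n Wn-unbounded disjoint
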